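{- Let $m\geq 3$ and let $\omega_1,\ldots,\omega_{m-1}$ be as in the context. Then for each $\nu=1,2,\ldots,m-1$, \[\mathrm{ord}_\infty\,\omega_\nu=\sum_{\mu=1}^{m-1}\frac{\mu^2}{4m}-\frac{\nu^2}{4m}.\]
   Context: $q=e^{2\pi i\tau}$. $\theta^*_{m,\mu}(\tau)=\sum_{r\in\mathbb Z,\,r\equiv\mu\bmod 2m} r\,q^{r^2/(4m)}$. $\mathcal W$ is the $(m-1)\times(m-1)$ matrix with $(j,\mu)$ entry $\frac{d^{\,j-1}}{d\tau^{\,j-1}}\theta^*_{m,\mu}$, $1\leq j,\mu\leq m-1$; $\omega_\nu=(-1)^{m-1+\nu}\det\mathcal W_{(m-1,\nu)}$, where $\mathcal W_{(m-1,\nu)}$ is $\mathcal W$ with its last row and $\nu$-th column deleted (so $(\omega_\nu/\det\mathcal W)_\nu$ is the last column of $\mathcal W^{ -1}$). For a nonzero function $f$ on $\mathbb H$ with an expansion in (rational) powers of $q$, $\mathrm{ord}_\infty f$ is the exponent of $q$ in the first nonzero term of the expansion. -}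

module Defs where

open import Data.Nat as ℕ using (ℕ; zero; suc; _∸_; _<_; _≤_)
open import Data.Integer as ℤ using (ℤ; +_; _-_; 0ℤ; 1ℤ)
open import Data.Integer.DivMod using (_%ℕ_)
open import Data.Fin using (Fin; toℕ; punchIn)
import Data.Fin as Fin
open import Data.Bool using (Bool; if_then_else_; _∧_)
open import Data.List using (List; map; upTo; foldr)
open import Relation.Nullary.Decidable using (⌊_⌋)
open import Relation.Binary.PropositionalEquality using (_≡_; _≢_)
open import Data.Product using (_×_)

-- Formal q-series with exponents in (1/(4m))ℤ_{≥0}:
-- a "Series" f stands for  Σ_{n ≥ 0} f n · q^{n/(4m)}  (the m is fixed by context).
Series : Set
Series = ℕ → ℤ

sumℤ : List ℤ → ℤ
sumℤ = foldr ℤ._+_ 0ℤ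

_⊕_ : Series → Series → Series
(f ⊕ g) n = f n ℤ.+ g n

_⊗_ : Series → Series → Series
(f ⊗ g) n = sumℤ (map (λ k → f k ℤ.* g (n ∸ k)) (upTo (suc n)))

⊝_ : Series → Series
(⊝ f) n = ℤ.- f n

zeroS : Series
zeroS _ = 0ℤ

oneS : Series
oneS zero    = 1ℤ
oneS (suc _) = 0ℤ

signS : ℕ → Series → Series
signS zero f          = f
signS (suc zero) f    = ⊝ f
signS (suc (suc k)) f = signS k f

-- congruence r ≡ s (mod d) for integers (d = 0 means equality)
congMod : ℕ → ℤ → ℤ → Bool
congMod zero    r s = ⌊ r ℤ.≟ s ⌋
congMod (suc k) r s = ⌊ (r - s) %ℕ suc k ℕ.≟ 0 ⌋

-- θ*_{m,μ} = Σ_{r ≡ μ mod 2m} r q^{r²/(4m)}; coefficient of q^{n/(4m)}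
-- is the sum of r over integers r with r² = n and r ≡ μ (mod 2m);
-- such r satisfy |r| ≤ n, so we sum over r ∈ [-n, n].
thetaStar : ℕ → ℕ → Series
thetaStar m μ n =
  sumℤ (map (λ k → let r = (+ k) - (+ n) in
                   if ⌊ r ℤ.* r ℤ.≟ + n ⌋ ∧ congMod (2 ℕ.* m) r (+ μ)
                   then r else 0ℤ)
            (upTo (suc (2 ℕ.* n))))

-- Normalised derivative  D = (4m / 2πi) d/dτ = 4m · q d/dq :
-- q^{n/(4m)} ↦ n q^{n/(4m)}.  It differs from d/dτ by the nonzero
-- constant factor 2πi/(4m).
D : Series → Series
D f n = + n ℤ.* f n

Diter : ℕ → Series → Series
Diter zero    f = f
Diter (suc j) f = D (Diter j f)

sumFin : (n : ℕ) → (Fin n → Series) → Series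
sumFin zero    f = zeroS
sumFin (suc n) f = f Fin.zero ⊕ sumFin n (λ i → f (Fin.suc i))

det : (n : ℕ) → (Fin n → Fin n → Series) → Series
det zero    M = oneS
det (suc n) M =
  sumFin (suc n) (λ j → signS (toℕ j)
    (M Fin.zero j ⊗ det n (λ a b → M (Fin.suc a) (punchIn j b))))

-- entry (j, μ) of 𝒲 (1-based indices, j, μ ∈ {1..m-1}), with D in place of d/dτ
Wentry : ℕ → ℕ → ℕ → Series
Wentry m j μ = Diter (j ∸ 1) (thetaStar m μ)

-- column index (1-based) of the c-th remaining column after deleting column ν
skipCol : ℕ → ℕ → ℕ
skipCol ν c = if ⌊ c ℕ.<? ν ⌋ then c else suc c

-- ω_ν = (-1)^{m-1+ν} det 𝒲_{(m-1,ν)}, an (m-2)×(m-2) determinant: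
-- rows 1..m-2 of 𝒲, columns {1..m-1} ∖ {ν}.
omega : ℕ → ℕ → Series
omega m ν = signS ((m ∸ 1) ℕ.+ ν)
  (det (m ∸ 2) (λ a b → Wentry m (suc (toℕ a)) (skipCol ν (suc (toℕ b)))))

-- ord_∞ f = N/(4m): the first nonzero coefficient of f is that of q^{N/(4m)}.
HasOrdIndex : Series → ℕ → Set
HasOrdIndex f N = (f N ≢ 0ℤ) × (∀ n → n < N → f n ≡ 0ℤ)

sumSq : ℕ → ℕ
sumSq m = foldr ℕ._+_ 0 (map (λ k → suc k ℕ.* suc k) (upTo (m ∸ 1)))

{-# OPTIONS --safe #-}
-- Let μ_b (b < m - 2) run through the columns {1, …, m - 1} ∖ {ν}. The series θ*_{m,μ} with
-- 0 < μ < m starts with μ q^{μ²/4m}: a term r q^{r²/4m} of lower or equal exponent has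
-- r² ≤ μ² and r ≡ μ (mod 2m), which forces r = μ. So every entry of column b of 𝒲_{(m-1,ν)}
-- starts at q^{μ_b²/4m}, and its leading coefficient in row a is (μ_b²)^a μ_b. A determinant
-- whose columns have orders e_b has order at least Σ_b e_b, with coefficient there the
-- determinant of the leading coefficients: ∏_b μ_b times the Vandermonde determinant of the
-- distinct nodes μ_b², which is nonzero.
module Submission where

open import Algebra.Structures using (IsCommutativeMonoid)
open import Data.Bool using (true; false; if_then_else_; _∧_)
open import Data.Bool.Properties using (T-≡)
open import Data.Empty using (⊥; ⊥-elim)
open import Data.Fin as Fin using (Fin; toℕ)
import Data.Fin.Properties as Finₚ
open import Data.Integer as ℤ using (ℤ; +_; 0ℤ; 1ℤ; -1ℤ; _+_; _*_; -_; _-_; _^_; ∣_∣)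
open import Data.Integer.DivMod using (_%ℕ_; _/ℕ_; a≡a%ℕn+[a/ℕn]*n)
import Data.Integer.Properties as ℤₚ
open import Data.Integer.Solver using (module +-*-Solver)
open import Data.List using (foldr; map; applyUpTo)
open import Data.Nat as ℕ using (ℕ; zero; suc; z≤n; s≤s; _≤_; _<_; _∸_)
import Data.Nat.Properties as ℕₚ
open import Data.Product using (∃; ∃₂; _×_; _,_; proj₁; proj₂)
open import Data.Sum using (_⊎_; inj₁; inj₂; [_,_]; [_,_]′; map₁) renaming (map to ⊎-map)
open import Function using (_∘_; id)
open import Function.Bundles using (Equivalence)
open import Relation.Binary.Definitions using (tri<; tri≈; tri>)
open import Relation.Binary.PropositionalEquality
  using (_≡_; _≢_; refl; sym; trans; cong; cong₂; subst; module ≡-Reasoning)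
open import Relation.Nullary using (Dec; yes; no)
open import Relation.Nullary.Decidable using (⌊_⌋; toWitness)

open import Defs

open +-*-Solver using (solve; _:+_; _:*_; _:-_; _:=_; con)

punchIn : ℕ → ℕ → ℕ
punchIn zero    b       = suc b
punchIn (suc j) zero    = zero
punchIn (suc j) (suc b) = suc (punchIn j b)

punchOut : ℕ → ℕ → ℕ
punchOut zero    j       = ℕ.pred j
punchOut (suc i) zero    = zero
punchOut (suc i) (suc j) = suc (punchOut i j)

adjacentSwap : ℕ → ℕ → ℕ
adjacentSwap zero    zero          = 1
adjacentSwap zero    (suc zero)    = 0
adjacentSwap zero    (suc (suc b)) = suc (suc b)
adjacentSwap (suc k) zero          = zero
adjacentSwap (suc k) (suc b)       = suc (adjacentSwap k b)

punchIn-< : ∀ j {b n} → b < n → punchIn j b < suc n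
punchIn-< zero                    b<n       = s≤s b<n
punchIn-< (suc j) {zero}          _         = s≤s z≤n
punchIn-< (suc j) {suc b} {suc n} (s≤s b<n) = s≤s (punchIn-< j b<n)

punchIn-injective : ∀ j {a b} → punchIn j a ≡ punchIn j b → a ≡ b
punchIn-injective zero                    eq = ℕₚ.suc-injective eq
punchIn-injective (suc j) {zero}  {zero}  _  = refl
punchIn-injective (suc j) {suc a} {suc b} eq =
  cong suc (punchIn-injective j (ℕₚ.suc-injective eq))

punchInᵢ≢i : ∀ i b → punchIn i b ≢ i
punchInᵢ≢i (suc i) (suc b) eq = punchInᵢ≢i i b (ℕₚ.suc-injective eq)

punchIn-below : ∀ {j b} → b < j → punchIn j b ≡ b
punchIn-below {suc j} {zero}  _         = refl
punchIn-below {suc j} {suc b} (s≤s b<j) = cong suc (punchIn-below b<j)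

punchIn-above : ∀ {j b} → j ≤ b → punchIn j b ≡ suc b
punchIn-above {zero}              _         = refl
punchIn-above {suc j} {suc b} (s≤s j≤b) = cong suc (punchIn-above j≤b)

punchIn-punchOut : ∀ {i j} → i ≢ j → punchIn i (punchOut i j) ≡ j
punchIn-punchOut {zero}  {zero}  i≢j = ⊥-elim (i≢j refl)
punchIn-punchOut {zero}  {suc j} _   = refl
punchIn-punchOut {suc i} {zero}  _   = refl
punchIn-punchOut {suc i} {suc j} i≢j = cong suc (punchIn-punchOut (i≢j ∘ cong suc))

punchIn≡⇒≡punchOut : ∀ i {j b} → punchIn i b ≡ j → b ≡ punchOut i j
punchIn≡⇒≡punchOut zero                    refl = refl
punchIn≡⇒≡punchOut (suc i) {zero}  {zero}  _    = refl
punchIn≡⇒≡punchOut (suc i) {suc j} {suc b} eq   =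
  cong suc (punchIn≡⇒≡punchOut i (ℕₚ.suc-injective eq))

punchOut-< : ∀ {n i j} → i < suc n → j < suc n → i ≢ j → punchOut i j < n
punchOut-< {_}     {zero}  {zero}  _         _         i≢j = ⊥-elim (i≢j refl)
punchOut-< {_}     {zero}  {suc j} _         (s≤s j<n) _   = j<n
punchOut-< {zero}  {suc i} {zero}  (s≤s ()) _         _
punchOut-< {suc n} {suc i} {zero}  _         _         _   = s≤s z≤n
punchOut-< {suc n} {suc i} {suc j} (s≤s i<n) (s≤s j<n) i≢j =
  s≤s (punchOut-< i<n j<n (i≢j ∘ cong suc))

toℕ-punchIn : ∀ {n} (i : Fin (suc n)) (j : Fin n) → toℕ (Fin.punchIn i j) ≡ punchIn (toℕ i) (toℕ j)
toℕ-punchIn Fin.zero    j          = refl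
toℕ-punchIn (Fin.suc i) Fin.zero    = refl
toℕ-punchIn (Fin.suc i) (Fin.suc j) = cong suc (toℕ-punchIn i j)

adjacentSwap-self : ∀ k → adjacentSwap k k ≡ suc k
adjacentSwap-self zero    = refl
adjacentSwap-self (suc k) = cong suc (adjacentSwap-self k)

adjacentSwap-suc : ∀ k → adjacentSwap k (suc k) ≡ k
adjacentSwap-suc zero    = refl
adjacentSwap-suc (suc k) = cong suc (adjacentSwap-suc k)

adjacentSwap-other : ∀ k {j} → j ≢ k → j ≢ suc k → adjacentSwap k j ≡ j
adjacentSwap-other zero    {zero}          j≢k _     = ⊥-elim (j≢k refl)
adjacentSwap-other zero    {suc zero}      _   j≢k+1 = ⊥-elim (j≢k+1 refl)
adjacentSwap-other zero    {suc (suc j)}   _   _     = refl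
adjacentSwap-other (suc k) {zero}          _   _     = refl
adjacentSwap-other (suc k) {suc j}         j≢k j≢k+1 =
  cong suc (adjacentSwap-other k (j≢k ∘ cong suc) (j≢k+1 ∘ cong suc))

adjacentSwap-punchIn-self : ∀ k b → adjacentSwap k (punchIn k b) ≡ punchIn (suc k) b
adjacentSwap-punchIn-self zero    zero    = refl
adjacentSwap-punchIn-self zero    (suc b) = refl
adjacentSwap-punchIn-self (suc k) zero    = refl
adjacentSwap-punchIn-self (suc k) (suc b) = cong suc (adjacentSwap-punchIn-self k b)

adjacentSwap-punchIn-suc : ∀ k b → adjacentSwap k (punchIn (suc k) b) ≡ punchIn k b
adjacentSwap-punchIn-suc zero    zero    = refl
adjacentSwap-punchIn-suc zero    (suc b) = refl
adjacentSwap-punchIn-suc (suc k) zero    = refl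
adjacentSwap-punchIn-suc (suc k) (suc b) = cong suc (adjacentSwap-punchIn-suc k b)

adjacentSwap-punchIn-above : ∀ k {j} → suc (suc k) ≤ j → ∀ b →
  adjacentSwap k (punchIn j b) ≡ punchIn j (adjacentSwap k b)
adjacentSwap-punchIn-above zero    {suc zero}    (s≤s ()) _
adjacentSwap-punchIn-above zero    {suc (suc j)} _ zero          = refl
adjacentSwap-punchIn-above zero    {suc (suc j)} _ (suc zero)    = refl
adjacentSwap-punchIn-above zero    {suc (suc j)} _ (suc (suc b)) = refl
adjacentSwap-punchIn-above (suc k) {suc j} _         zero    = refl
adjacentSwap-punchIn-above (suc k) {suc j} (s≤s k+2≤j) (suc b) =
  cong suc (adjacentSwap-punchIn-above k k+2≤j b)

adjacentSwap-punchIn-below : ∀ k {j} → j ≤ k → ∀ b →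
  adjacentSwap (suc k) (punchIn j b) ≡ punchIn j (adjacentSwap k b)
adjacentSwap-punchIn-below k       {zero}  _         b       = refl
adjacentSwap-punchIn-below (suc k) {suc j} _         zero    = refl
adjacentSwap-punchIn-below (suc k) {suc j} (s≤s j≤k) (suc b) =
  cong suc (adjacentSwap-punchIn-below k j≤k b)

module BigOperator {A : Set} {_∙_ : A → A → A} {ε : A}
                   (isCommutativeMonoid : IsCommutativeMonoid _≡_ _∙_ ε) where

  open IsCommutativeMonoid isCommutativeMonoid using (assoc; comm)

  big : ℕ → (ℕ → A) → A
  big zero    f = ε
  big (suc n) f = f 0 ∙ big n (f ∘ suc)

  big-cong : ∀ n {f g} → (∀ j → j < n → f j ≡ g j) → big n f ≡ big n g
  big-cong zero    _   = refl
  big-cong (suc n) f≗g =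
    cong₂ _∙_ (f≗g 0 (s≤s z≤n)) (big-cong n (λ j j<n → f≗g (suc j) (s≤s j<n)))

  private
    ∙-exchange : ∀ x y z → x ∙ (y ∙ z) ≡ y ∙ (x ∙ z)
    ∙-exchange x y z = trans (sym (assoc x y z)) (trans (cong (_∙ z) (comm x y)) (assoc y x z))

  big-punchIn : ∀ n {j} → j ≤ n → ∀ f → big (suc n) f ≡ f j ∙ big n (f ∘ punchIn j)
  big-punchIn n       {zero}  _         f = refl
  big-punchIn (suc n) {suc j} (s≤s j≤n) f =
    trans (cong (f 0 ∙_) (big-punchIn n j≤n (f ∘ suc))) (∙-exchange (f 0) (f (suc j)) _)

  big-adjacentSwap : ∀ n {k} → suc k < n → ∀ f → big n (f ∘ adjacentSwap k) ≡ big n f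
  big-adjacentSwap (suc (suc n)) {zero}  _         f = ∙-exchange (f 1) (f 0) _
  big-adjacentSwap (suc n)       {suc k} (s≤s k<n) f =
    cong (f 0 ∙_) (big-adjacentSwap n k<n (f ∘ suc))

  foldr-map-applyUpTo : ∀ {B : Set} n (h : B → A) (f : ℕ → B) →
    foldr _∙_ ε (map h (applyUpTo f n)) ≡ big n (h ∘ f)
  foldr-map-applyUpTo zero    h f = refl
  foldr-map-applyUpTo (suc n) h f = cong (h (f 0) ∙_) (foldr-map-applyUpTo n h (f ∘ suc))

module ∑ℤ = BigOperator ℤₚ.+-0-isCommutativeMonoid
module ∏ℤ = BigOperator ℤₚ.*-1-isCommutativeMonoid
module ∑ℕ = BigOperator ℕₚ.+-0-isCommutativeMonoid

∑ : ℕ → (ℕ → ℤ) → ℤ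
∑ = ∑ℤ.big

∏ : ℕ → (ℕ → ℤ) → ℤ
∏ = ∏ℤ.big

∑-distrib-+ : ∀ n f g → ∑ n (λ j → f j + g j) ≡ ∑ n f + ∑ n g
∑-distrib-+ zero    f g = refl
∑-distrib-+ (suc n) f g =
  trans (cong (_+_ (f 0 + g 0)) (∑-distrib-+ n (f ∘ suc) (g ∘ suc)))
        (solve 4 (λ a b c d → (a :+ b) :+ (c :+ d) := (a :+ c) :+ (b :+ d)) refl
               (f 0) (g 0) (∑ n (f ∘ suc)) (∑ n (g ∘ suc)))

∑-distribˡ-* : ∀ n s f → ∑ n (λ j → s * f j) ≡ s * ∑ n f
∑-distribˡ-* zero    s f = sym (ℤₚ.*-zeroʳ s)
∑-distribˡ-* (suc n) s f =
  trans (cong (_+_ (s * f 0)) (∑-distribˡ-* n s (f ∘ suc))) (sym (ℤₚ.*-distribˡ-+ s (f 0) _))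

∑-neg : ∀ n f → ∑ n (-_ ∘ f) ≡ - ∑ n f
∑-neg zero    f = refl
∑-neg (suc n) f =
  trans (cong (_+_ (- f 0)) (∑-neg n (f ∘ suc))) (sym (ℤₚ.neg-distrib-+ (f 0) _))

∑≡0 : ∀ n {f} → (∀ j → j < n → f j ≡ 0ℤ) → ∑ n f ≡ 0ℤ
∑≡0 zero    _  = refl
∑≡0 (suc n) f≡0 = cong₂ _+_ (f≡0 0 (s≤s z≤n)) (∑≡0 n (λ j j<n → f≡0 (suc j) (s≤s j<n)))

∑-single : ∀ n {a} f → a < n → (∀ j → j < n → j ≢ a → f j ≡ 0ℤ) → ∑ n f ≡ f a
∑-single (suc n) {zero}  f _         others =
  trans (cong (_+_ (f 0)) (∑≡0 n (λ j j<n → others (suc j) (s≤s j<n) λ ())))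
        (ℤₚ.+-identityʳ (f 0))
∑-single (suc n) {suc a} f (s≤s a<n) others =
  trans (cong₂ _+_ (others 0 (s≤s z≤n) λ ())
                   (∑-single n (f ∘ suc) a<n λ j j<n j≢a → others (suc j) (s≤s j<n) (j≢a ∘ ℕₚ.suc-injective)))
        (ℤₚ.+-identityˡ (f (suc a)))

∏≢0 : ∀ n {s} → (∀ j → j < n → s j ≢ 0ℤ) → ∏ n s ≢ 0ℤ
∏≢0 zero    _   ()
∏≢0 (suc n) s≢0 =
  [ s≢0 0 (s≤s z≤n) , ∏≢0 n (λ j j<n → s≢0 (suc j) (s≤s j<n)) ] ∘ ℤₚ.i*j≡0⇒i≡0∨j≡0 _

sign : ℕ → ℤ → ℤ
sign zero          z = z
sign (suc zero)    z = - z
sign (suc (suc k)) z = sign k z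

sign-suc : ∀ k z → sign (suc k) z ≡ - sign k z
sign-suc zero          z = refl
sign-suc (suc zero)    z = sym (ℤₚ.neg-involutive z)
sign-suc (suc (suc k)) z = sign-suc k z

sign-* : ∀ k s z → sign k (s * z) ≡ s * sign k z
sign-* zero          s z = refl
sign-* (suc zero)    s z = ℤₚ.neg-distribʳ-* s z
sign-* (suc (suc k)) s z = sign-* k s z

sign-neg : ∀ k z → sign k (- z) ≡ - sign k z
sign-neg zero          z = refl
sign-neg (suc zero)    z = refl
sign-neg (suc (suc k)) z = sign-neg k z

sign-+ : ∀ k a b → sign k (a + b) ≡ sign k a + sign k b
sign-+ zero          a b = refl
sign-+ (suc zero)    a b = ℤₚ.neg-distrib-+ a b
sign-+ (suc (suc k)) a b = sign-+ k a b

sign-+-* : ∀ k x s y → sign k (x + s * y) ≡ sign k x + s * sign k y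
sign-+-* k x s y = trans (sign-+ k x (s * y)) (cong (_+_ (sign k x)) (sign-* k s y))

sign-0 : ∀ k → sign k 0ℤ ≡ 0ℤ
sign-0 zero          = refl
sign-0 (suc zero)    = refl
sign-0 (suc (suc k)) = sign-0 k

sign≡0⇒≡0 : ∀ k {z} → sign k z ≡ 0ℤ → z ≡ 0ℤ
sign≡0⇒≡0 zero          eq = eq
sign≡0⇒≡0 (suc zero)    eq = trans (sym (ℤₚ.neg-involutive _)) (cong -_ eq)
sign≡0⇒≡0 (suc (suc k)) eq = sign≡0⇒≡0 k eq

-- Determinants of integer matrices

Matrix : Set
Matrix = ℕ → ℕ → ℤ

minor : Matrix → ℕ → Matrix
minor M j a b = M (suc a) (punchIn j b)

detℤ : ℕ → Matrix → ℤ
detℤ zero    M = 1ℤ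
detℤ (suc n) M = ∑ (suc n) (λ j → sign j (M 0 j * detℤ n (minor M j)))

laplaceTerm : ℕ → Matrix → ℕ → ℤ
laplaceTerm n M j = sign j (M 0 j * detℤ n (minor M j))

detℤ-cong : ∀ n {M N : Matrix} → (∀ a b → a < n → b < n → M a b ≡ N a b) → detℤ n M ≡ detℤ n N
detℤ-cong zero    _   = refl
detℤ-cong (suc n) M≗N = ∑ℤ.big-cong (suc n) λ j j<n →
  cong (sign j) (cong₂ _*_ (M≗N 0 j (s≤s z≤n) j<n)
    (detℤ-cong n λ a b a<n b<n → M≗N (suc a) (punchIn j b) (s≤s a<n) (punchIn-< j b<n)))

detℤ-scaleColumns : ∀ n s M → detℤ n (λ a b → s b * M a b) ≡ ∏ n s * detℤ n M
detℤ-scaleColumns zero    s M = refl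
detℤ-scaleColumns (suc n) s M = begin
  ∑ (suc n) (λ j → sign j ((s j * M 0 j) * detℤ n (λ a b → s (punchIn j b) * minor M j a b)))
    ≡⟨ ∑ℤ.big-cong (suc n) scaledTerm ⟩
  ∑ (suc n) (λ j → ∏ (suc n) s * sign j (M 0 j * detℤ n (minor M j)))
    ≡⟨ ∑-distribˡ-* (suc n) (∏ (suc n) s) (λ j → sign j (M 0 j * detℤ n (minor M j))) ⟩
  ∏ (suc n) s * detℤ (suc n) M ∎
  where
  open ≡-Reasoning
  scaledTerm : ∀ j → j < suc n →
    sign j ((s j * M 0 j) * detℤ n (λ a b → s (punchIn j b) * minor M j a b)) ≡
    ∏ (suc n) s * sign j (M 0 j * detℤ n (minor M j))
  scaledTerm j j<n = begin
    sign j ((s j * M 0 j) * detℤ n (λ a b → s (punchIn j b) * minor M j a b))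
      ≡⟨ cong (λ d → sign j ((s j * M 0 j) * d)) (detℤ-scaleColumns n (s ∘ punchIn j) (minor M j)) ⟩
    sign j ((s j * M 0 j) * (∏ n (s ∘ punchIn j) * detℤ n (minor M j)))
      ≡⟨ cong (sign j) (solve 4 (λ a b c d → (a :* b) :* (c :* d) := (a :* c) :* (b :* d)) refl
                               (s j) (M 0 j) (∏ n (s ∘ punchIn j)) (detℤ n (minor M j))) ⟩
    sign j ((s j * ∏ n (s ∘ punchIn j)) * (M 0 j * detℤ n (minor M j)))
      ≡⟨ cong (λ p → sign j (p * (M 0 j * detℤ n (minor M j)))) (∏ℤ.big-punchIn n (ℕₚ.≤-pred j<n) s) ⟨
    sign j (∏ (suc n) s * (M 0 j * detℤ n (minor M j)))
      ≡⟨ sign-* j (∏ (suc n) s) _ ⟩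
    ∏ (suc n) s * sign j (M 0 j * detℤ n (minor M j)) ∎

minor-adjacentSwap : ∀ n {k j} → suc k < suc n → j < suc n → j ≢ k → j ≢ suc k → ∀ M →
  detℤ n (λ a b → M (suc a) (adjacentSwap k (punchIn j b))) ≡ - detℤ n (minor M j)

detℤ-adjacentSwap : ∀ n {k} → suc k < n → ∀ M →
  detℤ n (λ a b → M a (adjacentSwap k b)) ≡ - detℤ n M
detℤ-adjacentSwap (suc n) {k} k+1<n M = begin
  ∑ (suc n) (λ j → sign j (M′ 0 j * detℤ n (minor M′ j)))
    ≡⟨ ∑ℤ.big-cong (suc n) swappedTerm ⟩
  ∑ (suc n) (-_ ∘ term ∘ adjacentSwap k)
    ≡⟨ ∑-neg (suc n) (term ∘ adjacentSwap k) ⟩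
  - ∑ (suc n) (term ∘ adjacentSwap k)
    ≡⟨ cong -_ (∑ℤ.big-adjacentSwap (suc n) k+1<n term) ⟩
  - detℤ (suc n) M ∎
  where
  open ≡-Reasoning
  M′ : Matrix
  M′ a b = M a (adjacentSwap k b)
  term : ℕ → ℤ
  term = laplaceTerm n M
  swappedTerm : ∀ j → j < suc n → sign j (M′ 0 j * detℤ n (minor M′ j)) ≡ - term (adjacentSwap k j)
  swappedTerm j j<n with j ℕ.≟ k | j ℕ.≟ suc k
  ... | yes refl | _ = begin
    sign k (M 0 (adjacentSwap k k) * detℤ n (minor M′ k))
      ≡⟨ cong₂ (λ c d → sign k (M 0 c * d)) (adjacentSwap-self k)
               (detℤ-cong n λ a b _ _ → cong (M (suc a)) (adjacentSwap-punchIn-self k b)) ⟩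
    sign k (M 0 (suc k) * detℤ n (minor M (suc k)))
      ≡⟨ ℤₚ.neg-involutive _ ⟨
    - - sign k (M 0 (suc k) * detℤ n (minor M (suc k)))
      ≡⟨ cong -_ (sign-suc k _) ⟨
    - term (suc k)
      ≡⟨ cong (-_ ∘ term) (adjacentSwap-self k) ⟨
    - term (adjacentSwap k k) ∎
  ... | no _ | yes refl = begin
    sign (suc k) (M 0 (adjacentSwap k (suc k)) * detℤ n (minor M′ (suc k)))
      ≡⟨ cong₂ (λ c d → sign (suc k) (M 0 c * d)) (adjacentSwap-suc k)
               (detℤ-cong n λ a b _ _ → cong (M (suc a)) (adjacentSwap-punchIn-suc k b)) ⟩
    sign (suc k) (M 0 k * detℤ n (minor M k))
      ≡⟨ sign-suc k _ ⟩
    - term k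
      ≡⟨ cong (-_ ∘ term) (adjacentSwap-suc k) ⟨
    - term (adjacentSwap k (suc k)) ∎
  ... | no j≢k | no j≢k+1 = begin
    sign j (M 0 (adjacentSwap k j) * detℤ n (minor M′ j))
      ≡⟨ cong₂ (λ c d → sign j (M 0 c * d)) (adjacentSwap-other k j≢k j≢k+1)
               (minor-adjacentSwap n k+1<n j<n j≢k j≢k+1 M) ⟩
    sign j (M 0 j * - detℤ n (minor M j))
      ≡⟨ cong (sign j) (ℤₚ.neg-distribʳ-* (M 0 j) _) ⟨
    sign j (- (M 0 j * detℤ n (minor M j)))
      ≡⟨ sign-neg j _ ⟩
    - term j
      ≡⟨ cong (-_ ∘ term) (adjacentSwap-other k j≢k j≢k+1) ⟨
    - term (adjacentSwap k j) ∎

minor-adjacentSwap n {k} {j} k+1<n j<n j≢k j≢k+1 M with suc (suc k) ℕ.≤? j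
... | yes k+2≤j =
  trans (detℤ-cong n λ a b _ _ → cong (M (suc a)) (adjacentSwap-punchIn-above k k+2≤j b))
        (detℤ-adjacentSwap n (ℕₚ.≤-trans k+2≤j (ℕₚ.≤-pred j<n)) (minor M j))
... | no  k+2≰j = below k j<k k+1<n
  where
  j<k : j < k
  j<k = ℕₚ.≤∧≢⇒< (ℕₚ.≤-pred (ℕₚ.≤∧≢⇒< (ℕₚ.≤-pred (ℕₚ.≰⇒> k+2≰j)) j≢k+1)) j≢k
  below : ∀ k → j < k → suc k < suc n →
    detℤ n (λ a b → M (suc a) (adjacentSwap k (punchIn j b))) ≡ - detℤ n (minor M j)
  below (suc k) (s≤s j≤k) (s≤s k+1<n) =
    trans (detℤ-cong n λ a b _ _ → cong (M (suc a)) (adjacentSwap-punchIn-below k j≤k b))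
          (detℤ-adjacentSwap n k+1<n (minor M j))

x≡-x⇒x≡0 : ∀ {x} → x ≡ - x → x ≡ 0ℤ
x≡-x⇒x≡0 {+ zero}    _  = refl
x≡-x⇒x≡0 {+ suc _}   ()
x≡-x⇒x≡0 {ℤ.-[1+ _ ]} ()

detℤ-equalColumns : ∀ n {p q} → p < q → q < n → ∀ M → (∀ a → M a p ≡ M a q) → detℤ n M ≡ 0ℤ
detℤ-equalColumns n {p} {suc q} p<q+1 q+1<n M Mp≡Mq with p ℕ.≟ q
... | yes refl = x≡-x⇒x≡0 (begin
  detℤ n M                                ≡⟨ detℤ-cong n (λ a b _ _ → swap-invariant a b) ⟨
  detℤ n (λ a b → M a (adjacentSwap p b)) ≡⟨ detℤ-adjacentSwap n q+1<n M ⟩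
  - detℤ n M                              ∎)
  where
  open ≡-Reasoning
  swap-invariant : ∀ a b → M a (adjacentSwap p b) ≡ M a b
  swap-invariant a b with b ℕ.≟ p | b ℕ.≟ suc p
  ... | yes refl | _        = trans (cong (M a) (adjacentSwap-self p)) (sym (Mp≡Mq a))
  ... | no _     | yes refl = trans (cong (M a) (adjacentSwap-suc p)) (Mp≡Mq a)
  ... | no b≢p   | no b≢p+1 = cong (M a) (adjacentSwap-other p b≢p b≢p+1)
... | no p≢q = begin
  detℤ n M                                ≡⟨ ℤₚ.neg-involutive _ ⟨
  - - detℤ n M                            ≡⟨ cong -_ (detℤ-adjacentSwap n q+1<n M) ⟨
  - detℤ n (λ a b → M a (adjacentSwap q b))
    ≡⟨ cong -_ (detℤ-equalColumns n p<q (ℕₚ.<-trans (ℕₚ.n<1+n q) q+1<n) _ swappedEqual) ⟩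
  - 0ℤ                                    ∎
  where
  open ≡-Reasoning
  p<q : p < q
  p<q = ℕₚ.≤∧≢⇒< (ℕₚ.≤-pred p<q+1) p≢q
  swappedEqual : ∀ a → M a (adjacentSwap q p) ≡ M a (adjacentSwap q q)
  swappedEqual a = begin
    M a (adjacentSwap q p) ≡⟨ cong (M a) (adjacentSwap-other q p≢q (ℕₚ.<⇒≢ (ℕₚ.m<n⇒m<1+n p<q))) ⟩
    M a p                  ≡⟨ Mp≡Mq a ⟩
    M a (suc q)            ≡⟨ cong (M a) (adjacentSwap-self q) ⟨
    M a (adjacentSwap q q) ∎

replaceColumn : Matrix → ℕ → (ℕ → ℤ) → Matrix
replaceColumn M j w a b with b ℕ.≟ j
... | yes _ = w a
... | no  _ = M a b

replaceColumn-≡ : ∀ M j w a → replaceColumn M j w a j ≡ w a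
replaceColumn-≡ M j w a with j ℕ.≟ j
... | yes _   = refl
... | no  j≢j = ⊥-elim (j≢j refl)

replaceColumn-≢ : ∀ M j w a {b} → b ≢ j → replaceColumn M j w a b ≡ M a b
replaceColumn-≢ M j w a {b} b≢j with b ℕ.≟ j
... | yes b≡j = ⊥-elim (b≢j b≡j)
... | no  _   = refl

minor-replaceColumn-self : ∀ M j w a b → minor (replaceColumn M j w) j a b ≡ minor M j a b
minor-replaceColumn-self M j w a b = replaceColumn-≢ M j w (suc a) (punchInᵢ≢i j b)

minor-replaceColumn : ∀ M {i j} w → i ≢ j → ∀ a b →
  minor (replaceColumn M j w) i a b ≡ replaceColumn (minor M i) (punchOut i j) (w ∘ suc) a b
minor-replaceColumn M {i} {j} w i≢j a b with b ℕ.≟ punchOut i j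
... | yes refl = trans (cong (replaceColumn M j w (suc a)) (punchIn-punchOut i≢j)) (replaceColumn-≡ M j w (suc a))
... | no  b≢j′ = replaceColumn-≢ M j w (suc a) (b≢j′ ∘ punchIn≡⇒≡punchOut i)

laplaceTerm-replaceColumn-self : ∀ n M j w →
  laplaceTerm n (replaceColumn M j w) j ≡ sign j (w 0 * detℤ n (minor M j))
laplaceTerm-replaceColumn-self n M j w =
  cong₂ (λ c d → sign j (c * d)) (replaceColumn-≡ M j w 0)
        (detℤ-cong n λ a b _ _ → minor-replaceColumn-self M j w a b)

laplaceTerm-replaceColumn-other : ∀ n M {i j} w → i ≢ j →
  laplaceTerm n (replaceColumn M j w) i ≡ sign i (M 0 i * detℤ n (replaceColumn (minor M i) (punchOut i j) (w ∘ suc)))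
laplaceTerm-replaceColumn-other n M {i} {j} w i≢j =
  cong₂ (λ c d → sign i (c * d)) (replaceColumn-≢ M j w 0 i≢j)
        (detℤ-cong n λ a b _ _ → minor-replaceColumn M w i≢j a b)

detℤ-linear : ∀ n {j} → j < n → ∀ M u v s →
  detℤ n (replaceColumn M j (λ a → u a + s * v a)) ≡
  detℤ n (replaceColumn M j u) + s * detℤ n (replaceColumn M j v)
detℤ-linear (suc n) {j} j<n M u v s = begin
  ∑ (suc n) (term (λ a → u a + s * v a))
    ≡⟨ ∑ℤ.big-cong (suc n) (λ i i<n → linearTerm i<n (i ℕ.≟ j)) ⟩
  ∑ (suc n) (λ i → term u i + s * term v i)
    ≡⟨ ∑-distrib-+ (suc n) (term u) (λ i → s * term v i) ⟩
  ∑ (suc n) (term u) + ∑ (suc n) (λ i → s * term v i)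
    ≡⟨ cong (_+_ (∑ (suc n) (term u))) (∑-distribˡ-* (suc n) s (term v)) ⟩
  ∑ (suc n) (term u) + s * ∑ (suc n) (term v) ∎
  where
  open ≡-Reasoning
  term : (ℕ → ℤ) → ℕ → ℤ
  term w = laplaceTerm n (replaceColumn M j w)
  linearTerm : ∀ {i} → i < suc n → Dec (i ≡ j) → term (λ a → u a + s * v a) i ≡ term u i + s * term v i
  linearTerm {i} _ (yes refl) = begin
    term (λ a → u a + s * v a) i               ≡⟨ laplaceTerm-replaceColumn-self n M i _ ⟩
    sign i ((u 0 + s * v 0) * d)               ≡⟨ cong (sign i) (solve 4
      (λ x y s d → (x :+ s :* y) :* d := x :* d :+ s :* (y :* d)) refl (u 0) (v 0) s d) ⟩
    sign i (u 0 * d + s * (v 0 * d))           ≡⟨ sign-+-* i _ s _ ⟩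
    sign i (u 0 * d) + s * sign i (v 0 * d)    ≡⟨ cong₂ (λ x y → x + s * y)
      (laplaceTerm-replaceColumn-self n M i u) (laplaceTerm-replaceColumn-self n M i v) ⟨
    term u i + s * term v i                    ∎
    where d = detℤ n (minor M i)
  linearTerm {i} i<n (no i≢j) = begin
    term (λ a → u a + s * v a) i                       ≡⟨ laplaceTerm-replaceColumn-other n M _ i≢j ⟩
    sign i (M 0 i * minorDet (λ a → u a + s * v a))    ≡⟨ cong (λ d → sign i (M 0 i * d))
      (detℤ-linear n (punchOut-< i<n j<n i≢j) (minor M i) (u ∘ suc) (v ∘ suc) s) ⟩
    sign i (M 0 i * (minorDet u + s * minorDet v))     ≡⟨ cong (sign i) (solve 4
      (λ m x s y → m :* (x :+ s :* y) := m :* x :+ s :* (m :* y)) refl (M 0 i) (minorDet u) s (minorDet v)) ⟩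
    sign i (M 0 i * minorDet u + s * (M 0 i * minorDet v))        ≡⟨ sign-+-* i _ s _ ⟩
    sign i (M 0 i * minorDet u) + s * sign i (M 0 i * minorDet v) ≡⟨ cong₂ (λ x y → x + s * y)
      (laplaceTerm-replaceColumn-other n M u i≢j) (laplaceTerm-replaceColumn-other n M v i≢j) ⟨
    term u i + s * term v i                            ∎
    where
    minorDet : (ℕ → ℤ) → ℤ
    minorDet w = detℤ n (replaceColumn (minor M i) (punchOut i j) (w ∘ suc))

detℤ-addMultipleOfColumn : ∀ n {i j} → i < n → j < n → i ≢ j → ∀ M s →
  detℤ n (replaceColumn M j (λ a → M a j + s * M a i)) ≡ detℤ n M
detℤ-addMultipleOfColumn n {i} {j} i<n j<n i≢j M s = begin
  detℤ n (replaceColumn M j (λ a → M a j + s * M a i))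
    ≡⟨ detℤ-linear n j<n M (λ a → M a j) (λ a → M a i) s ⟩
  detℤ n (replaceColumn M j (λ a → M a j)) + s * detℤ n (replaceColumn M j (λ a → M a i))
    ≡⟨ cong₂ (λ x y → x + s * y) (detℤ-cong n λ a b _ _ → unchanged a b) copyOfColumn-i ⟩
  detℤ n M + s * 0ℤ
    ≡⟨ cong (_+_ (detℤ n M)) (ℤₚ.*-zeroʳ s) ⟩
  detℤ n M + 0ℤ
    ≡⟨ ℤₚ.+-identityʳ (detℤ n M) ⟩
  detℤ n M ∎
  where
  open ≡-Reasoning
  unchanged : ∀ a b → replaceColumn M j (λ a → M a j) a b ≡ M a b
  unchanged a b with b ℕ.≟ j
  ... | yes refl = refl
  ... | no  _    = refl
  columns-i-j : ∀ a → replaceColumn M j (λ a → M a i) a i ≡ replaceColumn M j (λ a → M a i) a j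
  columns-i-j a = trans (replaceColumn-≢ M j _ a i≢j) (sym (replaceColumn-≡ M j _ a))
  copyOfColumn-i : detℤ n (replaceColumn M j (λ a → M a i)) ≡ 0ℤ
  copyOfColumn-i with ℕₚ.<-cmp i j
  ... | tri< i<j _   _   = detℤ-equalColumns n i<j j<n _ columns-i-j
  ... | tri≈ _   i≡j _   = ⊥-elim (i≢j i≡j)
  ... | tri> _   _   j<i = detℤ-equalColumns n j<i i<n _ (sym ∘ columns-i-j)

subtractColumn₀ : ℕ → Matrix → Matrix
subtractColumn₀ zero    M = M
subtractColumn₀ (suc k) M =
  replaceColumn (subtractColumn₀ k M) (suc k)
    (λ a → subtractColumn₀ k M a (suc k) + -1ℤ * subtractColumn₀ k M a 0)

subtractColumn₀-zero : ∀ k M a → subtractColumn₀ k M a 0 ≡ M a 0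
subtractColumn₀-zero zero    M a = refl
subtractColumn₀-zero (suc k) M a = subtractColumn₀-zero k M a

subtractColumn₀-above : ∀ k M a {b} → k < b → subtractColumn₀ k M a b ≡ M a b
subtractColumn₀-above zero    M a _   = refl
subtractColumn₀-above (suc k) M a k<b =
  trans (replaceColumn-≢ (subtractColumn₀ k M) (suc k) _ a (ℕₚ.<⇒≢ k<b ∘ sym))
        (subtractColumn₀-above k M a (ℕₚ.<-trans (ℕₚ.n<1+n k) k<b))

subtractColumn₀-inside : ∀ k M a {b} → 0 < b → b ≤ k → subtractColumn₀ k M a b ≡ M a b - M a 0
subtractColumn₀-inside zero    M a {suc b} _ ()
subtractColumn₀-inside (suc k) M a {b} 0<b b≤k+1 with b ℕ.≟ suc k
... | yes refl = cong₂ _+_ (subtractColumn₀-above k M a (ℕₚ.n<1+n k))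
                           (trans (cong (-1ℤ *_) (subtractColumn₀-zero k M a)) (ℤₚ.-1*i≡-i (M a 0)))
... | no  b≢k+1 = subtractColumn₀-inside k M a 0<b (ℕₚ.≤-pred (ℕₚ.≤∧≢⇒< b≤k+1 b≢k+1))

detℤ-subtractColumn₀ : ∀ n {k} → k < n → ∀ M → detℤ n (subtractColumn₀ k M) ≡ detℤ n M
detℤ-subtractColumn₀ n {zero}  _     M = refl
detℤ-subtractColumn₀ n {suc k} k+1<n M =
  trans (detℤ-addMultipleOfColumn n (ℕₚ.<-trans (s≤s z≤n) k+1<n) k+1<n (λ ()) (subtractColumn₀ k M) -1ℤ)
        (detℤ-subtractColumn₀ n (ℕₚ.<-trans (ℕₚ.n<1+n k) k+1<n) M)

detℤ-firstRowUnit : ∀ n M → M 0 0 ≡ 1ℤ → (∀ j → 0 < j → j < suc n → M 0 j ≡ 0ℤ) →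
  detℤ (suc n) M ≡ detℤ n (minor M 0)
detℤ-firstRowUnit n M M₀₀≡1 M₀ⱼ≡0 = begin
  ∑ (suc n) (λ j → sign j (M 0 j * detℤ n (minor M j)))
    ≡⟨ ∑-single (suc n) _ (s≤s z≤n) (λ j j<n j≢0 → offDiagonal j j<n j≢0) ⟩
  M 0 0 * detℤ n (minor M 0)
    ≡⟨ cong (_* detℤ n (minor M 0)) M₀₀≡1 ⟩
  1ℤ * detℤ n (minor M 0)
    ≡⟨ ℤₚ.*-identityˡ _ ⟩
  detℤ n (minor M 0) ∎
  where
  open ≡-Reasoning
  offDiagonal : ∀ j → j < suc n → j ≢ 0 → sign j (M 0 j * detℤ n (minor M j)) ≡ 0ℤ
  offDiagonal zero    _   0≢0 = ⊥-elim (0≢0 refl)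
  offDiagonal (suc j) j<n _   = begin
    sign (suc j) (M 0 (suc j) * detℤ n (minor M (suc j)))
      ≡⟨ cong (λ c → sign (suc j) (c * detℤ n (minor M (suc j)))) (M₀ⱼ≡0 (suc j) (s≤s z≤n) j<n) ⟩
    sign (suc j) 0ℤ
      ≡⟨ sign-0 (suc j) ⟩
    0ℤ ∎

-- Generalised Vandermonde determinants

Degree< : ℕ → (ℤ → ℤ) → Set
Degree< zero    f = ∀ t → f t ≡ 0ℤ
Degree< (suc n) f = ∃₂ λ (c : ℤ) (g : ℤ → ℤ) → Degree< n g × (∀ t → f t ≡ c + t * g t)

Monic : ℕ → (ℤ → ℤ) → Set
Monic zero    f = ∀ t → f t ≡ 1ℤ
Monic (suc n) f = ∃₂ λ (c : ℤ) (g : ℤ → ℤ) → Monic n g × (∀ t → f t ≡ c + t * g t)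

degree<-scale : ∀ n s {f} → Degree< n f → Degree< n (λ t → s * f t)
degree<-scale zero    s {f} f≡0 t = trans (cong (s *_) (f≡0 t)) (ℤₚ.*-zeroʳ s)
degree<-scale (suc n) s (c , g , g-deg , f≡) =
  s * c , (λ t → s * g t) , degree<-scale n s g-deg ,
  λ t → trans (cong (s *_) (f≡ t))
              (solve 4 (λ s c t a → s :* (c :+ t :* a) := s :* c :+ t :* (s :* a)) refl s c t (g t))

monic⇒degree< : ∀ n {f} → Monic n f → Degree< (suc n) f
monic⇒degree< zero    {f} f≡1 =
  1ℤ , (λ _ → 0ℤ) , (λ _ → refl) , λ t → trans (f≡1 t) (sym (cong (_+_ 1ℤ) (ℤₚ.*-zeroʳ t)))
monic⇒degree< (suc n) (c , g , g-monic , f≡) = c , g , monic⇒degree< n g-monic , f≡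

monic-+ : ∀ n {f h} → Monic n f → Degree< n h → Monic n (λ t → f t + h t)
monic-+ zero    f≡1 h≡0 t = cong₂ _+_ (f≡1 t) (h≡0 t)
monic-+ (suc n) (c , f′ , f′-monic , f≡) (d , h′ , h′-deg , h≡) =
  c + d , (λ t → f′ t + h′ t) , monic-+ n f′-monic h′-deg ,
  λ t → trans (cong₂ _+_ (f≡ t) (h≡ t))
              (solve 5 (λ c d t a b → (c :+ t :* a) :+ (d :+ t :* b) := (c :+ d) :+ t :* (a :+ b)) refl
                     c d t (f′ t) (h′ t))

monic-factor : ∀ n {f} x₀ → Monic (suc n) f → ∃ λ g → Monic n g × (∀ t → f t - f x₀ ≡ (t - x₀) * g t)
monic-factor zero {f} x₀ (c , k , k≡1 , f≡) = k , k≡1 , λ t → begin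
  f t - f x₀                   ≡⟨ cong₂ _-_ (f≡ t) (f≡ x₀) ⟩
  (c + t * k t) - (c + x₀ * k x₀) ≡⟨ cong₂ (λ p q → (c + t * p) - (c + x₀ * q)) (k≡1 t) (k≡1 x₀) ⟩
  (c + t * 1ℤ) - (c + x₀ * 1ℤ) ≡⟨ solve 3 (λ c t x → (c :+ t :* con 1ℤ) :- (c :+ x :* con 1ℤ)
                                                  := (t :- x) :* con 1ℤ) refl c t x₀ ⟩
  (t - x₀) * 1ℤ                ≡⟨ cong ((t - x₀) *_) (k≡1 t) ⟨
  (t - x₀) * k t               ∎
  where open ≡-Reasoning
monic-factor (suc n) {f} x₀ (c , k , k-monic , f≡) with monic-factor n x₀ k-monic
... | g , g-monic , k-factor =
  (λ t → k t + x₀ * g t) , monic-+ (suc n) k-monic (degree<-scale (suc n) x₀ (monic⇒degree< n g-monic)) ,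
  λ t → begin
    f t - f x₀                              ≡⟨ cong₂ _-_ (f≡ t) (f≡ x₀) ⟩
    (c + t * k t) - (c + x₀ * k x₀)         ≡⟨ solve 5 (λ c t x a b → (c :+ t :* a) :- (c :+ x :* b)
                                                  := (t :- x) :* a :+ x :* (a :- b)) refl c t x₀ (k t) (k x₀) ⟩
    (t - x₀) * k t + x₀ * (k t - k x₀)      ≡⟨ cong (λ z → (t - x₀) * k t + x₀ * z) (k-factor t) ⟩
    (t - x₀) * k t + x₀ * ((t - x₀) * g t)  ≡⟨ solve 4 (λ t x a g → (t :- x) :* a :+ x :* ((t :- x) :* g)
                                                  := (t :- x) :* (a :+ x :* g)) refl t x₀ (k t) (g t) ⟩
    (t - x₀) * (k t + x₀ * g t)             ∎
  where open ≡-Reasoning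

^-monic : ∀ a → Monic a (_^ a)
^-monic zero    t = refl
^-monic (suc a) = 0ℤ , _^ a , ^-monic a , λ t → sym (ℤₚ.+-identityˡ (t * t ^ a))

-- Subtracting the first column from the others clears the first row and leaves
-- the columns divisible by x b - x 0, with quotients again monic of one degree less.
vandermonde≢0 : ∀ n (x : ℕ → ℤ) → (∀ {i j} → i < n → j < n → x i ≡ x j → i ≡ j) →
  (p : ℕ → ℤ → ℤ) → (∀ a → Monic a (p a)) → detℤ n (λ a b → p a (x b)) ≢ 0ℤ
vandermonde≢0 zero    x _     p _       ()
vandermonde≢0 (suc n) x x-inj p p-monic det≡0 =
  vandermonde≢0 n (x ∘ suc) (λ i<n j<n → ℕₚ.suc-injective ∘ x-inj (s≤s i<n) (s≤s j<n)) q
                (λ a → proj₁ (proj₂ (factor a))) quotientDet≡0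
  where
  open ≡-Reasoning
  M : Matrix
  M a b = p a (x b)
  factor : ∀ a → ∃ λ g → Monic a g × (∀ t → p (suc a) t - p (suc a) (x 0) ≡ (t - x 0) * g t)
  factor a = monic-factor a (x 0) (p-monic (suc a))
  q : ℕ → ℤ → ℤ
  q a = proj₁ (factor a)
  S = subtractColumn₀ n M
  firstRow : ∀ j → 0 < j → j < suc n → S 0 j ≡ 0ℤ
  firstRow j 0<j j<n = trans (subtractColumn₀-inside n M 0 0<j (ℕₚ.≤-pred j<n))
                             (ℤₚ.i≡j⇒i-j≡0 (trans (p-monic 0 (x j)) (sym (p-monic 0 (x 0)))))
  factored : ∀ a b → a < n → b < n → minor S 0 a b ≡ (x (suc b) - x 0) * q a (x (suc b))
  factored a b _ b<n = trans (subtractColumn₀-inside n M (suc a) (s≤s z≤n) b<n)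
                             (proj₂ (proj₂ (factor a)) (x (suc b)))
  x-distinct : ∀ j → j < n → x (suc j) - x 0 ≢ 0ℤ
  x-distinct j j<n = (λ ()) ∘ x-inj (s≤s j<n) (s≤s z≤n) ∘ ℤₚ.i-j≡0⇒i≡j _ _
  factorisation : ∏ n (λ b → x (suc b) - x 0) * detℤ n (λ a b → q a (x (suc b))) ≡ 0ℤ
  factorisation = begin
    ∏ n (λ b → x (suc b) - x 0) * detℤ n (λ a b → q a (x (suc b)))
      ≡⟨ detℤ-scaleColumns n _ _ ⟨
    detℤ n (λ a b → (x (suc b) - x 0) * q a (x (suc b)))
      ≡⟨ detℤ-cong n factored ⟨
    detℤ n (minor S 0)
      ≡⟨ detℤ-firstRowUnit n S (trans (subtractColumn₀-zero n M 0) (p-monic 0 (x 0))) firstRow ⟨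
    detℤ (suc n) S
      ≡⟨ detℤ-subtractColumn₀ (suc n) ℕₚ.≤-refl M ⟩
    detℤ (suc n) M
      ≡⟨ det≡0 ⟩
    0ℤ ∎
  quotientDet≡0 : detℤ n (λ a b → q a (x (suc b))) ≡ 0ℤ
  quotientDet≡0 = [ ⊥-elim ∘ ∏≢0 n x-distinct , id ]′ (ℤₚ.i*j≡0⇒i≡0∨j≡0 _ factorisation)

-- Leading terms of q-series

VanishesBelow : Series → ℕ → Set
VanishesBelow f N = ∀ n → n < N → f n ≡ 0ℤ

HasLeadingTerm : Series → ℕ → ℤ → Set
HasLeadingTerm f N c = VanishesBelow f N × f N ≡ c

hasLeadingTerm⇒hasOrdIndex : ∀ {f N c} → HasLeadingTerm f N c → c ≢ 0ℤ → HasOrdIndex f N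
hasLeadingTerm⇒hasOrdIndex (f-vanishes , fN≡c) c≢0 = c≢0 ∘ trans (sym fN≡c) , f-vanishes

Diter-apply : ∀ a f n → Diter a f n ≡ (+ n) ^ a * f n
Diter-apply zero    f n = sym (ℤₚ.*-identityˡ (f n))
Diter-apply (suc a) f n = trans (cong (+ n *_) (Diter-apply a f n)) (sym (ℤₚ.*-assoc (+ n) _ (f n)))

signS-apply : ∀ k f n → signS k f n ≡ sign k (f n)
signS-apply zero          f n = refl
signS-apply (suc zero)    f n = refl
signS-apply (suc (suc k)) f n = signS-apply k f n

sumFin-apply : ∀ n (F : Fin n → Series) k (g : ℕ → ℤ) → (∀ j → F j k ≡ g (toℕ j)) → sumFin n F k ≡ ∑ n g
sumFin-apply zero    F k g _   = refl
sumFin-apply (suc n) F k g F≗g =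
  cong₂ _+_ (F≗g Fin.zero) (sumFin-apply n (F ∘ Fin.suc) k (g ∘ suc) (F≗g ∘ Fin.suc))

⊗-apply : ∀ f g n → (f ⊗ g) n ≡ ∑ (suc n) (λ k → f k * g (n ∸ k))
⊗-apply f g n = ∑ℤ.foldr-map-applyUpTo (suc n) (λ k → f k * g (n ∸ k)) id

private
  m<n+o⇒m∸p<o : ∀ {m n o p} → n ≤ p → p ≤ m → m < n ℕ.+ o → m ∸ p < o
  m<n+o⇒m∸p<o {m} {n} {o} {p} n≤p p≤m m<n+o = ℕₚ.+-cancelʳ-< p (m ∸ p) o (begin-strict
    m ∸ p ℕ.+ p ≡⟨ ℕₚ.m∸n+n≡m p≤m ⟩
    m           <⟨ m<n+o ⟩
    n ℕ.+ o     ≤⟨ ℕₚ.+-monoˡ-≤ o n≤p ⟩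
    p ℕ.+ o     ≡⟨ ℕₚ.+-comm p o ⟩
    o ℕ.+ p     ∎)
    where open ℕₚ.≤-Reasoning

  product-vanishes : ∀ {f g a b n k} → VanishesBelow f a → VanishesBelow g b →
    n ∸ k < b ⊎ k < a → f k * g (n ∸ k) ≡ 0ℤ
  product-vanishes {f} {g} {n = n} {k} _ g-vanishes (inj₁ n∸k<b) =
    trans (cong (f k *_) (g-vanishes (n ∸ k) n∸k<b)) (ℤₚ.*-zeroʳ (f k))
  product-vanishes {f} {g} {n = n} {k} f-vanishes _ (inj₂ k<a) = cong (_* g (n ∸ k)) (f-vanishes k k<a)

⊗-vanishesBelow : ∀ {f g a b} → VanishesBelow f a → VanishesBelow g b → VanishesBelow (f ⊗ g) (a ℕ.+ b)
⊗-vanishesBelow {f} {g} {a} f-vanishes g-vanishes n n<a+b =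
  trans (⊗-apply f g n) (∑≡0 (suc n) λ k k<n+1 → product-vanishes f-vanishes g-vanishes
    (map₁ (λ a≤k → m<n+o⇒m∸p<o a≤k (ℕₚ.≤-pred k<n+1) n<a+b) (ℕₚ.≤-<-connex a k)))

⊗-leading : ∀ {f g a b} → VanishesBelow f a → VanishesBelow g b → (f ⊗ g) (a ℕ.+ b) ≡ f a * g b
⊗-leading {f} {g} {a} {b} f-vanishes g-vanishes = begin
  (f ⊗ g) (a ℕ.+ b)                      ≡⟨ ⊗-apply f g (a ℕ.+ b) ⟩
  ∑ (suc (a ℕ.+ b)) (λ k → f k * g (a ℕ.+ b ∸ k))
    ≡⟨ ∑-single (suc (a ℕ.+ b)) _ (s≤s (ℕₚ.m≤m+n a b)) others ⟩
  f a * g (a ℕ.+ b ∸ a)                  ≡⟨ cong (λ c → f a * g c) (ℕₚ.m+n∸m≡n a b) ⟩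
  f a * g b                              ∎
  where
  open ≡-Reasoning
  others : ∀ k → k < suc (a ℕ.+ b) → k ≢ a → f k * g (a ℕ.+ b ∸ k) ≡ 0ℤ
  others k k<n+1 k≢a = product-vanishes f-vanishes g-vanishes
    (⊎-map (λ a<k → m<n+o⇒m∸p<o a<k (ℕₚ.≤-pred k<n+1) (ℕₚ.n<1+n (a ℕ.+ b)))
         (λ k≤a → ℕₚ.≤∧≢⇒< (ℕₚ.≤-pred k≤a) k≢a)
         (ℕₚ.≤-<-connex (suc a) k))

⊗-hasLeadingTerm : ∀ {f g a b x y} → HasLeadingTerm f a x → HasLeadingTerm g b y →
  HasLeadingTerm (f ⊗ g) (a ℕ.+ b) (x * y)
⊗-hasLeadingTerm (f-vanishes , fa≡x) (g-vanishes , gb≡y) =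
  ⊗-vanishesBelow f-vanishes g-vanishes ,
  trans (⊗-leading f-vanishes g-vanishes) (cong₂ _*_ fa≡x gb≡y)

signS-hasLeadingTerm : ∀ k {f N c} → HasLeadingTerm f N c → HasLeadingTerm (signS k f) N (sign k c)
signS-hasLeadingTerm k {f} {N} (f-vanishes , fN≡c) =
  (λ n n<N → trans (signS-apply k f n) (trans (cong (sign k) (f-vanishes n n<N)) (sign-0 k))) ,
  trans (signS-apply k f N) (cong (sign k) fN≡c)

sumFin-hasLeadingTerm : ∀ n {F : Fin n → Series} {N} {c : ℕ → ℤ} →
  (∀ j → HasLeadingTerm (F j) N (c (toℕ j))) → HasLeadingTerm (sumFin n F) N (∑ n c)
sumFin-hasLeadingTerm n {F} {N} {c} F-leading =
  (λ k k<N → trans (sumFin-apply n F k (λ _ → 0ℤ) (λ j → proj₁ (F-leading j) k k<N))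
                   (∑≡0 n λ _ _ → refl)) ,
  sumFin-apply n F N c (proj₂ ∘ F-leading)

Diter-hasLeadingTerm : ∀ a {f N c} → HasLeadingTerm f N c → HasLeadingTerm (Diter a f) N ((+ N) ^ a * c)
Diter-hasLeadingTerm a {f} {N} (f-vanishes , fN≡c) =
  (λ n n<N → trans (Diter-apply a f n)
                   (trans (cong ((+ n) ^ a *_) (f-vanishes n n<N)) (ℤₚ.*-zeroʳ ((+ n) ^ a)))) ,
  trans (Diter-apply a f N) (cong ((+ N) ^ a *_) fN≡c)

-- In the Laplace expansion along the first row every term M 0 j ⊗ (minor j) starts at the
-- same exponent: e j from the entry plus the exponents of the remaining columns.
det-hasLeadingTerm : ∀ n (M : Fin n → Fin n → Series) (e : ℕ → ℕ) (C : Matrix) →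
  (∀ a b → HasLeadingTerm (M a b) (e (toℕ b)) (C (toℕ a) (toℕ b))) →
  HasLeadingTerm (det n M) (∑ℕ.big n e) (detℤ n C)
det-hasLeadingTerm zero    M e C _         = (λ _ ()) , refl
det-hasLeadingTerm (suc n) M e C M-leading =
  sumFin-hasLeadingTerm (suc n) {c = λ j → sign j (C 0 j * detℤ n (minor C j))} λ j →
    signS-hasLeadingTerm (toℕ j)
      (subst (λ N → HasLeadingTerm (M Fin.zero j ⊗ minorDet j) N
                                   (C 0 (toℕ j) * detℤ n (minor C (toℕ j))))
             (sym (∑ℕ.big-punchIn n (ℕₚ.≤-pred (Finₚ.toℕ<n j)) e))
             (⊗-hasLeadingTerm (M-leading Fin.zero j) (minor-hasLeadingTerm j)))
  where
  minorDet : Fin (suc n) → Series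
  minorDet j = det n (λ a b → M (Fin.suc a) (Fin.punchIn j b))
  minor-hasLeadingTerm : ∀ j →
    HasLeadingTerm (minorDet j) (∑ℕ.big n (e ∘ punchIn (toℕ j))) (detℤ n (minor C (toℕ j)))
  minor-hasLeadingTerm j = det-hasLeadingTerm n _ (e ∘ punchIn (toℕ j)) (minor C (toℕ j)) λ a b →
    subst (λ c → HasLeadingTerm (M (Fin.suc a) (Fin.punchIn j b)) (e c) (C (suc (toℕ a)) c))
          (toℕ-punchIn j b) (M-leading (Fin.suc a) (Fin.punchIn j b))

-- The series θ*

thetaTerm : ℕ → ℕ → ℕ → ℤ → ℤ
thetaTerm m μ n r = if ⌊ r * r ℤ.≟ + n ⌋ ∧ congMod (2 ℕ.* m) r (+ μ) then r else 0ℤ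

thetaStar-∑ : ∀ m μ n → thetaStar m μ n ≡ ∑ (suc (2 ℕ.* n)) (λ k → thetaTerm m μ n (+ k - + n))
thetaStar-∑ m μ n = ∑ℤ.foldr-map-applyUpTo (suc (2 ℕ.* n)) (λ k → thetaTerm m μ n (+ k - + n)) id

thetaTerm-≡0 : ∀ m μ n r → (r * r ≡ + n → congMod (2 ℕ.* m) r (+ μ) ≡ true → ⊥) → thetaTerm m μ n r ≡ 0ℤ
thetaTerm-≡0 m μ n r not-both with r * r ℤ.≟ + n
... | no  _     = refl
... | yes r²≡n with congMod (2 ℕ.* m) r (+ μ)
...   | true  = ⊥-elim (not-both r²≡n refl)
...   | false = refl

thetaTerm-≡r : ∀ m μ n r → r * r ≡ + n → congMod (2 ℕ.* m) r (+ μ) ≡ true → thetaTerm m μ n r ≡ r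
thetaTerm-≡r m μ n r r²≡n r≡μ with r * r ℤ.≟ + n
... | no  r²≢n = ⊥-elim (r²≢n r²≡n)
... | yes _ rewrite r≡μ = refl

congMod-refl : ∀ m μ → congMod (2 ℕ.* suc m) (+ μ) (+ μ) ≡ true
congMod-refl m μ rewrite ℤₚ.+-inverseʳ (+ μ) = refl

m*m≤n*n⇒m≤n : ∀ {m n} → m ℕ.* m ≤ n ℕ.* n → m ≤ n
m*m≤n*n⇒m≤n m²≤n² = ℕₚ.≮⇒≥ λ n<m → ℕₚ.<⇒≱ (ℕₚ.*-mono-< n<m n<m) m²≤n²

m*m≡n*n⇒m≡n : ∀ {m n} → m ℕ.* m ≡ n ℕ.* n → m ≡ n
m*m≡n*n⇒m≡n m²≡n² =
  ℕₚ.≤-antisym (m*m≤n*n⇒m≤n (ℕₚ.≤-reflexive m²≡n²)) (m*m≤n*n⇒m≤n (ℕₚ.≤-reflexive (sym m²≡n²)))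

m≤m*m : ∀ m → m ≤ m ℕ.* m
m≤m*m zero    = z≤n
m≤m*m (suc m) = ℕₚ.m≤m*n (suc m) (suc m)

m*n<n⇒m≡0 : ∀ m {n} → m ℕ.* n < n → m ≡ 0
m*n<n⇒m≡0 zero    _      = refl
m*n<n⇒m≡0 (suc m) {n} lt = ⊥-elim (ℕₚ.<⇒≱ lt (ℕₚ.m≤m+n n (m ℕ.* n)))

-- |r - μ| ≤ |r| + μ ≤ 2μ < 2m, and |r - μ| is a multiple of 2m.
congMod-root : ∀ {m μ n r} → μ < m → n ≤ μ ℕ.* μ → r * r ≡ + n →
  congMod (2 ℕ.* m) r (+ μ) ≡ true → r ≡ + μ
congMod-root {suc m′} {μ} {n} {r} μ<m n≤μ² r²≡n r≡μ =
  ℤₚ.i-j≡0⇒i≡j r (+ μ) (ℤₚ.∣i∣≡0⇒i≡0 (trans multiple (cong (ℕ._* d) ∣q∣≡0)))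
  where
  d = 2 ℕ.* suc m′
  q = (r - + μ) /ℕ d
  multiple : ∣ r - + μ ∣ ≡ ∣ q ∣ ℕ.* d
  multiple = begin
    ∣ r - + μ ∣                         ≡⟨ cong ∣_∣ (a≡a%ℕn+[a/ℕn]*n (r - + μ) d) ⟩
    ∣ + ((r - + μ) %ℕ d) + q * + d ∣    ≡⟨ cong (λ z → ∣ + z + q * + d ∣)
                                                 (toWitness (Equivalence.from T-≡ r≡μ)) ⟩
    ∣ 0ℤ + q * + d ∣                    ≡⟨ cong ∣_∣ (ℤₚ.+-identityˡ (q * + d)) ⟩
    ∣ q * + d ∣                         ≡⟨ ℤₚ.abs-* q (+ d) ⟩
    ∣ q ∣ ℕ.* d                         ∎
    where open ≡-Reasoning
  ∣r∣≤μ : ∣ r ∣ ≤ μ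
  ∣r∣≤μ = m*m≤n*n⇒m≤n (subst (_≤ μ ℕ.* μ) (trans (cong ∣_∣ (sym r²≡n)) (ℤₚ.abs-* r r)) n≤μ²)
  ∣r-μ∣<d : ∣ r - + μ ∣ < d
  ∣r-μ∣<d = begin-strict
    ∣ r - + μ ∣       ≤⟨ ℤₚ.∣i-j∣≤∣i∣+∣j∣ r (+ μ) ⟩
    ∣ r ∣ ℕ.+ μ       ≤⟨ ℕₚ.+-monoˡ-≤ μ ∣r∣≤μ ⟩
    μ ℕ.+ μ           <⟨ ℕₚ.+-mono-< μ<m μ<m ⟩
    suc m′ ℕ.+ suc m′ ≡⟨ cong (suc m′ ℕ.+_) (ℕₚ.+-identityʳ (suc m′)) ⟨
    d                 ∎
    where open ℕₚ.≤-Reasoning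
  ∣q∣≡0 : ∣ q ∣ ≡ 0
  ∣q∣≡0 = m*n<n⇒m≡0 ∣ q ∣ (subst (_< d) multiple ∣r-μ∣<d)

thetaStar-hasLeadingTerm : ∀ {m μ} → μ < m → HasLeadingTerm (thetaStar m μ) (μ ℕ.* μ) (+ μ)
thetaStar-hasLeadingTerm {suc m′} {μ} μ<m = vanishes , leading
  where
  m = suc m′
  N = μ ℕ.* μ
  square≡ : ∀ {r n} → r ≡ + μ → r * r ≡ + n → n ≡ N
  square≡ {n = n} refl μ²≡n = ℤₚ.+-injective (trans (sym μ²≡n) (sym (ℤₚ.pos-* μ μ)))
  vanishes : VanishesBelow (thetaStar m μ) N
  vanishes n n<N = trans (thetaStar-∑ m μ n) (∑≡0 (suc (2 ℕ.* n)) λ k _ →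
    thetaTerm-≡0 m μ n (+ k - + n) λ r²≡n r≡μ →
      ℕₚ.<⇒≢ n<N (square≡ (congMod-root {r = + k - + n} μ<m (ℕₚ.<⇒≤ n<N) r²≡n r≡μ) r²≡n))
  root : + (N ℕ.+ μ) - + N ≡ + μ
  root = trans (cong (_- + N) (ℤₚ.pos-+ N μ)) (solve 2 (λ a b → (a :+ b) :- a := b) refl (+ N) (+ μ))
  others : ∀ k → k < suc (2 ℕ.* N) → k ≢ N ℕ.+ μ → thetaTerm m μ N (+ k - + N) ≡ 0ℤ
  others k _ k≢N+μ = thetaTerm-≡0 m μ N (+ k - + N) λ r²≡N r≡μ → k≢N+μ (ℤₚ.+-injective (begin
    + k                  ≡⟨ solve 2 (λ a b → a := (a :- b) :+ b) refl (+ k) (+ N) ⟩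
    (+ k - + N) + + N    ≡⟨ cong (_+ + N) (congMod-root {r = + k - + N} μ<m ℕₚ.≤-refl r²≡N r≡μ) ⟩
    + μ + + N            ≡⟨ ℤₚ.pos-+ μ N ⟨
    + (μ ℕ.+ N)          ≡⟨ cong +_ (ℕₚ.+-comm μ N) ⟩
    + (N ℕ.+ μ)          ∎))
    where open ≡-Reasoning
  leading : thetaStar m μ N ≡ + μ
  leading = begin
    thetaStar m μ N                                         ≡⟨ thetaStar-∑ m μ N ⟩
    ∑ (suc (2 ℕ.* N)) (λ k → thetaTerm m μ N (+ k - + N))  ≡⟨ ∑-single (suc (2 ℕ.* N)) _
      (s≤s (ℕₚ.+-monoʳ-≤ N (ℕₚ.≤-trans (m≤m*m μ) (ℕₚ.m≤m+n N 0)))) others ⟩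
    thetaTerm m μ N (+ (N ℕ.+ μ) - + N)                     ≡⟨ cong (thetaTerm m μ N) root ⟩
    thetaTerm m μ N (+ μ)                                   ≡⟨ thetaTerm-≡r m μ N (+ μ)
                                                                 (sym (ℤₚ.pos-* μ μ)) (congMod-refl m′ μ) ⟩
    + μ                                                     ∎
    where open ≡-Reasoning

Wentry-hasLeadingTerm : ∀ {m μ} a → μ < m →
  HasLeadingTerm (Wentry m (suc a) μ) (μ ℕ.* μ) ((+ (μ ℕ.* μ)) ^ a * + μ)
Wentry-hasLeadingTerm a μ<m = Diter-hasLeadingTerm a (thetaStar-hasLeadingTerm μ<m)

skipCol-suc : ∀ ν′ b → skipCol (suc ν′) (suc b) ≡ suc (punchIn ν′ b)
skipCol-suc ν′ b with suc b ℕ.<? suc ν′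
... | yes (s≤s b<ν′) = cong suc (sym (punchIn-below b<ν′))
... | no  b+1≮ν′+1   = cong suc (sym (punchIn-above (ℕₚ.≮⇒≥ (b+1≮ν′+1 ∘ s≤s))))

sumSq-∸-square : ∀ n {ν′} → ν′ ≤ n →
  sumSq (suc (suc n)) ∸ suc ν′ ℕ.* suc ν′ ≡ ∑ℕ.big n (λ b → suc (punchIn ν′ b) ℕ.* suc (punchIn ν′ b))
sumSq-∸-square n {ν′} ν′≤n = begin
  sumSq (suc (suc n)) ∸ square ν′
    ≡⟨ cong (_∸ square ν′) (∑ℕ.foldr-map-applyUpTo (suc n) square id) ⟩
  ∑ℕ.big (suc n) square ∸ square ν′
    ≡⟨ cong (_∸ square ν′) (∑ℕ.big-punchIn n ν′≤n square) ⟩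
  square ν′ ℕ.+ ∑ℕ.big n (square ∘ punchIn ν′) ∸ square ν′
    ≡⟨ ℕₚ.m+n∸m≡n (square ν′) _ ⟩
  ∑ℕ.big n (square ∘ punchIn ν′) ∎
  where
  open ≡-Reasoning
  square : ℕ → ℕ
  square k = suc k ℕ.* suc k

detℤ-powerColumns≢0 : ∀ n (x y : ℕ → ℤ) → (∀ {i j} → i < n → j < n → x i ≡ x j → i ≡ j) →
  (∀ b → b < n → y b ≢ 0ℤ) → detℤ n (λ a b → x b ^ a * y b) ≢ 0ℤ
detℤ-powerColumns≢0 n x y x-injective y≢0 det≡0 =
  [ ∏≢0 n y≢0 , vandermonde≢0 n x x-injective (λ a → _^ a) ^-monic ]′ (ℤₚ.i*j≡0⇒i≡0∨j≡0 _ (begin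
    ∏ n y * detℤ n (λ a b → x b ^ a) ≡⟨ detℤ-scaleColumns n y _ ⟨
    detℤ n (λ a b → y b * x b ^ a)   ≡⟨ detℤ-cong n (λ a b _ _ → ℤₚ.*-comm (y b) (x b ^ a)) ⟩
    detℤ n (λ a b → x b ^ a * y b)   ≡⟨ det≡0 ⟩
    0ℤ                               ∎))
  where open ≡-Reasoning

lemma4p2 : ∀ (m : ℕ) → 3 ≤ m → ∀ (ν : ℕ) → 1 ≤ ν → ν ≤ m ∸ 1 →
    HasOrdIndex (omega m ν) (sumSq m ∸ ν ℕ.* ν)
lemma4p2 (suc (suc (suc k))) _ (suc ν′) _ (s≤s ν′≤n) =
  subst (HasOrdIndex (omega m (suc ν′))) (sym (sumSq-∸-square n ν′≤n))
    (hasLeadingTerm⇒hasOrdIndex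
      (signS-hasLeadingTerm (suc n ℕ.+ suc ν′) (det-hasLeadingTerm n W e C W-hasLeadingTerm))
      (detC≢0 ∘ sign≡0⇒≡0 (suc n ℕ.+ suc ν′)))
  where
  n = suc k
  m = suc (suc n)
  μ e : ℕ → ℕ
  μ b = suc (punchIn ν′ b)
  e b = μ b ℕ.* μ b
  C : Matrix
  C a b = (+ e b) ^ a * + μ b
  W : Fin n → Fin n → Series
  W a b = Wentry m (suc (toℕ a)) (skipCol (suc ν′) (suc (toℕ b)))
  W-hasLeadingTerm : ∀ a b → HasLeadingTerm (W a b) (e (toℕ b)) (C (toℕ a) (toℕ b))
  W-hasLeadingTerm a b rewrite skipCol-suc ν′ (toℕ b) =
    Wentry-hasLeadingTerm (toℕ a) (s≤s (punchIn-< ν′ (Finₚ.toℕ<n b)))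
  detC≢0 : detℤ n C ≢ 0ℤ
  detC≢0 = detℤ-powerColumns≢0 n (+_ ∘ e) (+_ ∘ μ)
    (λ _ _ → punchIn-injective ν′ ∘ ℕₚ.suc-injective ∘ m*m≡n*n⇒m≡n ∘ ℤₚ.+-injective) (λ _ _ ())
lemma4p2 (suc (suc (suc k))) _ zero                  () _
lemma4p2 (suc (suc zero))      (s≤s (s≤s ())) _ _ _
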